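{- Let $f_i\colon M_i\to M_{i+1}$ ($i\geqslant 0$) be a lattice series in which each lattice $M_i$ is distributive. Then for each $n$ the partial sum $\Sigma_nM_n$ is a distributive lattice.
   Context: A lattice series is an infinite sequence of lattices $M_0,M_1,\dots$ and maps $f_i\colon M_i\to M_{i+1}$ that preserve binary joins, are order-reflecting (i.e., $f_i(a)\leqslant f_i(b)$ implies $a\leqslant b$), and have down-closed images. The partial sum $\Sigma_nM_n$ is the poset whose elements are the pairs $(x,j)$ with $0\leqslant j\leqslant n$ and $x\in M_j$, ordered by $(x,j)\leqslant(y,k)$ iff $j\leqslant k$ and $(f_{k-1}\circ\dots\circ f_j)(x)\leqslant y$ in $M_k$ (identity composite when $j=k$). A lattice is distributive if $x\wedge(y\vee z)=(x\wedge y)\vee(x\wedge z)$ for all $x,y,z$. -}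

module Defs where

open import Level using (Level; _⊔_) renaming (zero to lzero)
open import Data.Nat using (ℕ; suc; _≤_; _≤′_; ≤′-refl; ≤′-step)
open import Data.Product using (Σ; _×_; _,_; ∃)
open import Relation.Binary.PropositionalEquality using (_≡_; subst)
open import Relation.Binary.Lattice.Bundles using (DistributiveLattice)

record DistributiveLatticeSeries (c ℓ₁ ℓ₂ : Level) : Set (Level.suc (c ⊔ ℓ₁ ⊔ ℓ₂)) where
  field
    M : ℕ → DistributiveLattice c ℓ₁ ℓ₂

  C : ℕ → Set c
  C i = DistributiveLattice.Carrier (M i)

  module L (i : ℕ) = DistributiveLattice (M i)

  field
    f            : (i : ℕ) → C i → C (suc i)
    f-cong       : (i : ℕ) {a b : C i} → L._≈_ i a b → L._≈_ (suc i) (f i a) (f i b)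
    f-∨          : (i : ℕ) (a b : C i) →
                   L._≈_ (suc i) (f i (L._∨_ i a b)) (L._∨_ (suc i) (f i a) (f i b))
    f-reflect    : (i : ℕ) {a b : C i} → L._≤_ (suc i) (f i a) (f i b) → L._≤_ i a b
    f-downClosed : (i : ℕ) (a : C i) (y : C (suc i)) →
                   L._≤_ (suc i) y (f i a) → Σ (C i) (λ z → L._≈_ (suc i) (f i z) y)

  comp : {j k : ℕ} → j ≤′ k → C j → C k
  comp ≤′-refl     x = x
  comp (≤′-step p) x = f _ (comp p x)

  ΣCarrier : ℕ → Set c
  ΣCarrier n = Σ ℕ (λ j → j ≤ n × C j)

  _≤Σ_ : {n : ℕ} → ΣCarrier n → ΣCarrier n → Set ℓ₂
  (j , _ , x) ≤Σ (k , _ , y) = Σ (j ≤′ k) (λ p → L._≤_ k (comp p x) y)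

  _≈Σ_ : {n : ℕ} → ΣCarrier n → ΣCarrier n → Set ℓ₁
  (j , _ , x) ≈Σ (k , _ , y) = Σ (j ≡ k) (λ e → L._≈_ k (subst C e x) y)

-- Send (j , x) to (j , image of x in M n).  Order-reflection of the maps makes this an order
-- embedding of the partial sum into the product of the chain ℕ with M n, and it carries the join
-- formed at level j ⊔ k to the componentwise join.  Down-closed images let the meet in M n be
-- pulled back to level j ⊓ k, giving a meet carried to the componentwise meet.  So the partial
-- sum is a sublattice of the distributive lattice ℕ × M n.
module Submission where

open import Defs
open import Level using (Level; _⊔_)
open import Data.Nat using (ℕ)
open import Data.Product using (Σ; _×_)
open import Algebra.Core using (Op₂)
open import Relation.Binary.Lattice.Structures using (IsDistributiveLattice)

open import Data.Nat as ℕ using (suc; _≤′_; ≤′-refl; ≤′-step)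
open import Data.Nat.Properties as ℕ
  using (≤⇒≤′; ≤′⇒≤; ≤′-trans; ≤-irrelevant; 1+n≰n)
open import Data.Product using (_,_; proj₁; proj₂)
open import Data.Product.Relation.Binary.Pointwise.NonDependent using (×-isPartialOrder)
open import Data.Sum using ([_,_]′)
open import Data.Empty using (⊥-elim)
open import Relation.Binary.Core using (Rel)
open import Relation.Binary.Lattice.Bundles using (DistributiveLattice)
open import Relation.Binary.Morphism.Structures using (IsOrderMonomorphism)
open import Relation.Binary.PropositionalEquality as ≡ using (_≡_; refl; cong)
import Relation.Binary.Lattice.Properties.JoinSemilattice as JoinSemilatticeProperties
import Relation.Binary.Lattice.Properties.MeetSemilattice as MeetSemilatticeProperties
import Relation.Binary.Reasoning.Setoid as SetoidReasoning

≤′-irrelevant : ∀ {m n} (p q : m ≤′ n) → p ≡ q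
≤′-irrelevant ≤′-refl     ≤′-refl     = refl
≤′-irrelevant ≤′-refl     (≤′-step q) = ⊥-elim (1+n≰n (≤′⇒≤ q))
≤′-irrelevant (≤′-step p) ≤′-refl     = ⊥-elim (1+n≰n (≤′⇒≤ p))
≤′-irrelevant (≤′-step p) (≤′-step q) = cong ≤′-step (≤′-irrelevant p q)

≤-distributiveLattice : DistributiveLattice Level.zero Level.zero Level.zero
≤-distributiveLattice = record
  { isDistributiveLattice = record
    { isLattice = record
      { isPartialOrder = ℕ.≤-isPartialOrder
      ; supremum       = λ m n → ℕ.m≤m⊔n m n , ℕ.m≤n⊔m m n , λ _ → ℕ.⊔-lub
      ; infimum        = λ m n → ℕ.m⊓n≤m m n , ℕ.m⊓n≤n m n , λ _ → ℕ.⊓-glb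
      }
    ; ∧-distribˡ-∨ = ℕ.⊓-distribˡ-⊔
    }
  }

×-distributiveLattice : ∀ {c₁ ℓ₁ ℓ₂ c₂ ℓ₃ ℓ₄} →
  DistributiveLattice c₁ ℓ₁ ℓ₂ → DistributiveLattice c₂ ℓ₃ ℓ₄ →
  DistributiveLattice (c₁ ⊔ c₂) (ℓ₁ ⊔ ℓ₃) (ℓ₂ ⊔ ℓ₄)
×-distributiveLattice D E = record
  { _∨_ = λ (x₁ , x₂) (y₁ , y₂) → x₁ D.∨ y₁ , x₂ E.∨ y₂
  ; _∧_ = λ (x₁ , x₂) (y₁ , y₂) → x₁ D.∧ y₁ , x₂ E.∧ y₂
  ; isDistributiveLattice = record
    { isLattice = record
      { isPartialOrder = ×-isPartialOrder D.isPartialOrder E.isPartialOrder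
      ; supremum       = λ (x₁ , x₂) (y₁ , y₂) →
          (D.x≤x∨y x₁ y₁ , E.x≤x∨y x₂ y₂) , (D.y≤x∨y x₁ y₁ , E.y≤x∨y x₂ y₂) ,
          λ _ (p₁ , p₂) (q₁ , q₂) → D.∨-least p₁ q₁ , E.∨-least p₂ q₂
      ; infimum        = λ (x₁ , x₂) (y₁ , y₂) →
          (D.x∧y≤x x₁ y₁ , E.x∧y≤x x₂ y₂) , (D.x∧y≤y x₁ y₁ , E.x∧y≤y x₂ y₂) ,
          λ _ (p₁ , p₂) (q₁ , q₂) → D.∧-greatest p₁ q₁ , E.∧-greatest p₂ q₂
      }
    ; ∧-distribˡ-∨ = λ (x₁ , x₂) (y₁ , y₂) (z₁ , z₂) →
        D.∧-distribˡ-∨ x₁ y₁ z₁ , E.∧-distribˡ-∨ x₂ y₂ z₂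
    }
  }
  where
  module D = DistributiveLattice D
  module E = DistributiveLattice E

module _ {a ℓ₁ ℓ₂ c ℓ₃ ℓ₄} {A : Set a} {_≈_ : Rel A ℓ₁} {_≤_ : Rel A ℓ₂} {_∨_ _∧_ : Op₂ A}
         (D : DistributiveLattice c ℓ₃ ℓ₄) {ι : A → DistributiveLattice.Carrier D}
  where
  private
    module D = DistributiveLattice D

  isDistributiveLattice-pullback :
    IsOrderMonomorphism _≈_ D._≈_ _≤_ D._≤_ ι →
    (∀ x y → ι (x ∨ y) D.≈ (ι x D.∨ ι y)) →
    (∀ x y → ι (x ∧ y) D.≈ (ι x D.∧ ι y)) →
    IsDistributiveLattice _≈_ _≤_ _∨_ _∧_
  isDistributiveLattice-pullback mono ι-∨ ι-∧ = record
    { isLattice = record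
      { isPartialOrder = record
        { isPreorder = record
          { isEquivalence = record
            { refl  = ι.injective D.Eq.refl
            ; sym   = λ x≈y → ι.injective (D.Eq.sym (ι.cong x≈y))
            ; trans = λ x≈y y≈z → ι.injective (D.Eq.trans (ι.cong x≈y) (ι.cong y≈z))
            }
          ; reflexive = λ x≈y → ι.cancel (D.reflexive (ι.cong x≈y))
          ; trans     = λ x≤y y≤z → ι.cancel (D.trans (ι.mono x≤y) (ι.mono y≤z))
          }
        ; antisym = λ x≤y y≤x → ι.injective (D.antisym (ι.mono x≤y) (ι.mono y≤x))
        }
      ; supremum = λ x y →
          ι.cancel (D.trans (D.x≤x∨y (ι x) (ι y)) (D.reflexive (D.Eq.sym (ι-∨ x y)))) ,
          ι.cancel (D.trans (D.y≤x∨y (ι x) (ι y)) (D.reflexive (D.Eq.sym (ι-∨ x y)))) ,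
          λ z x≤z y≤z → ι.cancel
            (D.trans (D.reflexive (ι-∨ x y)) (D.∨-least (ι.mono x≤z) (ι.mono y≤z)))
      ; infimum = λ x y →
          ι.cancel (D.trans (D.reflexive (ι-∧ x y)) (D.x∧y≤x (ι x) (ι y))) ,
          ι.cancel (D.trans (D.reflexive (ι-∧ x y)) (D.x∧y≤y (ι x) (ι y))) ,
          λ z z≤x z≤y → ι.cancel
            (D.trans (D.∧-greatest (ι.mono z≤x) (ι.mono z≤y)) (D.reflexive (D.Eq.sym (ι-∧ x y))))
      }
    ; ∧-distribˡ-∨ = λ x y z → ι.injective (begin
        ι (x ∧ (y ∨ z))                 ≈⟨ ι-∧ x (y ∨ z) ⟩
        ι x D.∧ ι (y ∨ z)               ≈⟨ ∧-cong D.Eq.refl (ι-∨ y z) ⟩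
        ι x D.∧ (ι y D.∨ ι z)           ≈⟨ D.∧-distribˡ-∨ (ι x) (ι y) (ι z) ⟩
        (ι x D.∧ ι y) D.∨ (ι x D.∧ ι z) ≈⟨ ∨-cong (ι-∧ x y) (ι-∧ x z) ⟨
        ι (x ∧ y) D.∨ ι (x ∧ z)         ≈⟨ ι-∨ (x ∧ y) (x ∧ z) ⟨
        ι ((x ∧ y) ∨ (x ∧ z))           ∎)
    }
    where
    module ι = IsOrderMonomorphism mono
    open JoinSemilatticeProperties D.joinSemilattice using (∨-cong)
    open MeetSemilatticeProperties D.meetSemilattice using (∧-cong)
    open SetoidReasoning D.setoid

module _ {c ℓ₁ ℓ₂} (S : DistributiveLatticeSeries c ℓ₁ ℓ₂) where
  open DistributiveLatticeSeries S

  f-mono : ∀ i {a b} → L._≤_ i a b → L._≤_ (suc i) (f i a) (f i b)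
  f-mono i {a} {b} a≤b = L.trans (suc i) (L.x≤x∨y (suc i) (f i a) (f i b))
    (L.reflexive (suc i) (L.Eq.trans (suc i) (L.Eq.sym (suc i) (f-∨ i a b)) (f-cong i a∨b≈b)))
    where open JoinSemilatticeProperties (L.joinSemilattice i) using (x≤y⇒x∨y≈y)
          a∨b≈b = x≤y⇒x∨y≈y a≤b

  comp-∘ : ∀ {i j k} (p : i ≤′ j) (q : j ≤′ k) (r : i ≤′ k) x → comp q (comp p x) ≡ comp r x
  comp-∘ p ≤′-refl     r x = cong (λ s → comp s x) (≤′-irrelevant p r)
  comp-∘ p (≤′-step q) r x rewrite ≤′-irrelevant r (≤′-step (≤′-trans p q)) =
    cong (f _) (comp-∘ p q (≤′-trans p q) x)

  comp-cong : ∀ {j k} (p : j ≤′ k) {a b} → L._≈_ j a b → L._≈_ k (comp p a) (comp p b)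
  comp-cong ≤′-refl     a≈b = a≈b
  comp-cong (≤′-step p) a≈b = f-cong _ (comp-cong p a≈b)

  comp-∨ : ∀ {j k} (p : j ≤′ k) a b → L._≈_ k (comp p (L._∨_ j a b)) (L._∨_ k (comp p a) (comp p b))
  comp-∨ ≤′-refl         a b = L.Eq.refl _
  comp-∨ (≤′-step {k} p) a b = L.Eq.trans (suc k) (f-cong k (comp-∨ p a b)) (f-∨ k _ _)

  comp-mono : ∀ {j k} (p : j ≤′ k) {a b} → L._≤_ j a b → L._≤_ k (comp p a) (comp p b)
  comp-mono ≤′-refl     a≤b = a≤b
  comp-mono (≤′-step p) a≤b = f-mono _ (comp-mono p a≤b)

  comp-reflect : ∀ {j k} (p : j ≤′ k) {a b} → L._≤_ k (comp p a) (comp p b) → L._≤_ j a b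
  comp-reflect ≤′-refl     le = le
  comp-reflect (≤′-step p) le = comp-reflect p (f-reflect _ le)

  comp-injective : ∀ {j k} (p : j ≤′ k) {a b} → L._≈_ k (comp p a) (comp p b) → L._≈_ j a b
  comp-injective {j} {k} p e =
    L.antisym j (comp-reflect p (L.reflexive k e)) (comp-reflect p (L.reflexive k (L.Eq.sym k e)))

  comp-downClosed : ∀ {j k} (p : j ≤′ k) a {y} → L._≤_ k y (comp p a) →
                    Σ (C j) λ z → L._≈_ k (comp p z) y
  comp-downClosed ≤′-refl         a {y} _   = y , L.Eq.refl _
  comp-downClosed (≤′-step {k} p) a     y≤ with f-downClosed k (comp p a) _ y≤
  ... | z₁ , fz₁≈y =
    let z₁≤ = f-reflect k (L.trans (suc k) (L.reflexive (suc k) fz₁≈y) y≤)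
        z , z≈z₁ = comp-downClosed p a z₁≤
    in z , L.Eq.trans (suc k) (f-cong k z≈z₁) fz₁≈y

  module _ (n : ℕ) where
    private
      module Mₙ = L n
      module D  = DistributiveLattice (×-distributiveLattice ≤-distributiveLattice (M n))

    up : ∀ {j} → j ℕ.≤ n → C j → C n
    up j≤n = comp (≤⇒≤′ j≤n)

    up-comp : ∀ {j k} (p : j ≤′ k) (k≤n : k ℕ.≤ n) (j≤n : j ℕ.≤ n) x → up k≤n (comp p x) ≡ up j≤n x
    up-comp p k≤n j≤n = comp-∘ p (≤⇒≤′ k≤n) (≤⇒≤′ j≤n)

    embed : ΣCarrier n → ℕ × C n
    embed (j , j≤n , x) = j , up j≤n x

    embed-isOrderMonomorphism : IsOrderMonomorphism (_≈Σ_ {n}) D._≈_ (_≤Σ_ {n}) D._≤_ embed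
    embed-isOrderMonomorphism = record
      { isOrderHomomorphism = record
        { cong = λ {a b} → cong′ {a} {b}
        ; mono = λ {a b} → mono {a} {b}
        }
      ; injective           = λ {a b} → injective {a} {b}
      ; cancel              = λ {a b} → cancel {a} {b}
      }
      where
      cong′ : ∀ {a b} → _≈Σ_ {n} a b → embed a D.≈ embed b
      cong′ {_ , j≤n , _} {_ , j≤n′ , _} (refl , x≈y)
        rewrite ≤-irrelevant j≤n j≤n′ = refl , comp-cong (≤⇒≤′ j≤n′) x≈y

      injective : ∀ {a b} → embed a D.≈ embed b → _≈Σ_ {n} a b
      injective {_ , j≤n , _} {_ , j≤n′ , _} (refl , e)
        rewrite ≤-irrelevant j≤n j≤n′ = refl , comp-injective (≤⇒≤′ j≤n′) e

      mono : ∀ {a b} → _≤Σ_ {n} a b → embed a D.≤ embed b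
      mono {_ , j≤n , x} {_ , k≤n , _} (p , px≤y) =
        ≤′⇒≤ p , Mₙ.trans (Mₙ.reflexive (Mₙ.Eq.reflexive (≡.sym (up-comp p k≤n j≤n x))))
                          (comp-mono (≤⇒≤′ k≤n) px≤y)

      cancel : ∀ {a b} → embed a D.≤ embed b → _≤Σ_ {n} a b
      cancel {_ , j≤n , x} {_ , k≤n , _} (j≤k , u≤v) =
        ≤⇒≤′ j≤k , comp-reflect (≤⇒≤′ k≤n)
          (Mₙ.trans (Mₙ.reflexive (Mₙ.Eq.reflexive (up-comp (≤⇒≤′ j≤k) k≤n j≤n x))) u≤v)

    _∨Σ_ : Op₂ (ΣCarrier n)
    (j , j≤n , x) ∨Σ (k , k≤n , y) =
      j ℕ.⊔ k , ℕ.⊔-lub j≤n k≤n ,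
      L._∨_ (j ℕ.⊔ k) (comp (≤⇒≤′ (ℕ.m≤m⊔n j k)) x) (comp (≤⇒≤′ (ℕ.m≤n⊔m j k)) y)

    embed-∨ : ∀ a b → embed (a ∨Σ b) D.≈ (embed a D.∨ embed b)
    embed-∨ (j , j≤n , x) (k , k≤n , y) = refl , Mₙ.Eq.trans (comp-∨ (≤⇒≤′ j⊔k≤n) _ _)
      (Mₙ.Eq.reflexive (≡.cong₂ Mₙ._∨_ (up-comp (≤⇒≤′ (ℕ.m≤m⊔n j k)) j⊔k≤n j≤n x)
                                         (up-comp (≤⇒≤′ (ℕ.m≤n⊔m j k)) j⊔k≤n k≤n y)))
      where j⊔k≤n = ℕ.⊔-lub j≤n k≤n

    preimage : ∀ {m j} (m≤n : m ℕ.≤ n) (j≤n : j ℕ.≤ n) → m ≡ j →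
               ∀ x {u} → u Mₙ.≤ up j≤n x → Σ (C m) λ z → up m≤n z Mₙ.≈ u
    preimage m≤n j≤n refl x u≤
      rewrite ≤-irrelevant m≤n j≤n = comp-downClosed (≤⇒≤′ j≤n) x u≤

    -- j ⊓ k is j or k, so the meet in M n lies below an element coming from level j ⊓ k.
    meetPreimage : ∀ {j k} (j≤n : j ℕ.≤ n) (k≤n : k ℕ.≤ n) x y →
                   Σ (C (j ℕ.⊓ k)) λ z → up (ℕ.m≤n⇒m⊓o≤n k j≤n) z Mₙ.≈ (up j≤n x Mₙ.∧ up k≤n y)
    meetPreimage {j} {k} j≤n k≤n x y =
      [ (λ e → preimage j⊓k≤n j≤n e x (Mₙ.x∧y≤x _ _))
      , (λ e → preimage j⊓k≤n k≤n e y (Mₙ.x∧y≤y _ _))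
      ]′ (ℕ.⊓-sel j k)
      where j⊓k≤n = ℕ.m≤n⇒m⊓o≤n k j≤n

    _∧Σ_ : Op₂ (ΣCarrier n)
    (j , j≤n , x) ∧Σ (k , k≤n , y) =
      j ℕ.⊓ k , ℕ.m≤n⇒m⊓o≤n k j≤n , proj₁ (meetPreimage j≤n k≤n x y)

    embed-∧ : ∀ a b → embed (a ∧Σ b) D.≈ (embed a D.∧ embed b)
    embed-∧ (j , j≤n , x) (k , k≤n , y) = refl , proj₂ (meetPreimage j≤n k≤n x y)

theorem3p2 : {c ℓ₁ ℓ₂ : Level} (S : DistributiveLatticeSeries c ℓ₁ ℓ₂) (n : ℕ) →
    let open DistributiveLatticeSeries S in
    Σ (Op₂ (ΣCarrier n)) (λ _∨_ → Σ (Op₂ (ΣCarrier n)) (λ _∧_ →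
      IsDistributiveLattice (_≈Σ_ {n}) (_≤Σ_ {n}) _∨_ _∧_))
theorem3p2 S n =
  _∨Σ_ S n , _∧Σ_ S n ,
  isDistributiveLattice-pullback (×-distributiveLattice ≤-distributiveLattice (M n))
    (embed-isOrderMonomorphism S n) (embed-∨ S n) (embed-∧ S n)
  where open DistributiveLatticeSeries S using (M)
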